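{- Let $\mathcal{D}=(D_1,\dots,D_k)$ be a $k$-clustering of a $\pm$-labeled complete graph on $V$, let $\beta>0$, and let $S\subseteq V$ be a $\beta$-good sample with respect to $\mathcal{D}$, with the partition $\tilde S=(S_1,\dots,S_k)$, $S_i=S\cap D_i$. For each $u\in V\setminus S$, let $j_u$ be an index maximizing $\mathrm{pval}^{\tilde S}(u,i)$ over $i\in\{1,\dots,k\}$, and say $u$ is placed in cluster $C_{j_u}$. Suppose a vertex $u\in D_s$ is placed in cluster $C_r$ with $r\neq s$, $1\le r,s\le k$. Then $\mathrm{pval}^{\mathcal{D}}(u,r)\ge \mathrm{pval}^{\mathcal{D}}(u,s)-2\beta=\mathrm{val}^{\mathcal{D}}(u)-2\beta$.
   Context: A $k$-clustering is a partition of $V$ ($|V|=n$) into at most $k$ parts $(A_1,\dots,A_k)$. An edge is an agreement of a clustering if it is a $+$ edge with both endpoints in the same part or a $-$ edge with endpoints in different parts. For a clustering $\mathcal{A}$, $\mathrm{val}^{\mathcal{A}}(u)$ is the fraction of the $n-1$ edges incident to $u$ that are agreements of $\mathcal{A}$. $\mathcal{A}^{(u,i)}$ is the clustering obtained from $\mathcal{A}$ by moving $u$ to $A_i$, and $\mathrm{pval}^{\mathcal{A}}(u,i)$ is the fraction of edges incident to $u$ that are agreements of $\mathcal{A}^{(u,i)}$. For $S\subseteq V$ partitioned as $\tilde S=(S_1,\dots,S_k)$, $\mathrm{pval}^{\tilde S}(u,i)$ is $1/|S|$ times the number of agreements on edges connecting $u$ to vertices of $S$ when $u$ is placed in cluster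 $i$ together with $S_i$ and each $S_l$ forms cluster $l$. $S$ is $\beta$-good with respect to $\mathcal{D}$ if its elements are distinct and $|\mathrm{pval}^{\tilde S}(u,i)-\mathrm{pval}^{\mathcal{D}}(u,i)|\le\beta$ for all $u\in V$, $i\in\{1,\dots,k\}$, where $S_i=S\cap D_i$. -}

module Defs where

open import Data.Nat using (ℕ; zero; suc; _∸_)
open import Data.Bool using (Bool; true; false; not; _∧_; if_then_else_)
open import Data.Fin using (Fin; _≟_)
open import Data.List using (List; []; _∷_; length)
open import Data.Integer using (+_)
open import Data.Rational using (ℚ; 0ℚ; _/_; _-_; _≤_; ∣_∣)
open import Relation.Nullary using (does; ¬_)
open import Data.List.Relation.Unary.Unique.Propositional using (Unique)
open import Data.List.Membership.Propositional using (_∈_)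
open import Data.Fin.Base using (Fin)
open import Data.List using (allFin)

-- A ±-labeled complete graph on V = Fin n: label u v = true means a + edge,
-- false means a − edge (only meaningful for u ≠ v).
Labeling : ℕ → Set
Labeling n = Fin n → Fin n → Bool

-- A k-clustering of V = Fin n: each vertex is assigned one of k clusters
-- (parts may be empty, so "at most k parts").
Clustering : ℕ → ℕ → Set
Clustering n k = Fin n → Fin k

count : {A : Set} → (A → Bool) → List A → ℕ
count p [] = 0
count p (x ∷ xs) = if p x then suc (count p xs) else count p xs

-- a / b as a rational, with the convention a / 0 = 0
frac : ℕ → ℕ → ℚ
frac a zero = 0ℚ
frac a (suc b) = (+ a) / suc b

agree : {k : ℕ} → Bool → Fin k → Fin k → Bool
agree true  i c = does (i ≟ c)
agree false i c = not (does (i ≟ c))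

neq : {n : ℕ} → Fin n → Fin n → Bool
neq u v = not (does (u ≟ v))

pvalD : {n k : ℕ} → Labeling n → Clustering n k → Fin n → Fin k → ℚ
pvalD {n} lab D u i =
  frac (count (λ v → neq u v ∧ agree (lab u v) i (D v)) (allFin n)) (n ∸ 1)

valD : {n k : ℕ} → Labeling n → Clustering n k → Fin n → ℚ
valD lab D u = pvalD lab D u (D u)

-- pval^{S~}(u,i) with S_l = S ∩ D_l: agreements on edges from u to S
-- (u placed in cluster i), divided by |S|
pvalS : {n k : ℕ} → Labeling n → Clustering n k → List (Fin n) → Fin n → Fin k → ℚ
pvalS lab D S u i =
  frac (count (λ v → neq u v ∧ agree (lab u v) i (D v)) S) (length S)

BetaGood : {n k : ℕ} → Labeling n → Clustering n k → ℚ → List (Fin n) → Set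
BetaGood {n} {k} lab D β S =
  Unique S × ((u : Fin n) (i : Fin k) → ∣ pvalS lab D S u i - pvalD lab D u i ∣ ≤ β)
  where open import Data.Product using (_×_)

-- The sample estimates pval^S~ are within β of the true pval^D, so choosing r
-- as a maximiser of the estimate loses at most 2β against the true optimum:
-- pval^D(u,s) ≤ pval^S~(u,s) + β ≤ pval^S~(u,r) + β ≤ pval^D(u,r) + 2β.
module Submission where

open import Defs
open import Data.Nat using (ℕ)
open import Data.Fin using (Fin)
open import Data.List using (List)
open import Data.List.Membership.Propositional using (_∈_)
open import Data.Product using (_×_; _,_)
open import Data.Integer using (+_; -[1+_])
open import Data.Rational using (ℚ; mkℚ; 0ℚ; _<_; _≤_; _-_; _+_; -_; ∣_∣)
open import Data.Rational.Properties
  using (≤-refl; ≤-trans; ≤-reflexive; <⇒≤; +-assoc; +-comm; +-monoˡ-≤; +-monoʳ-≤;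
         negative⁻¹; 0≤∣p∣; ∣-p∣≡∣p∣; +-0-group; +-0-abelianGroup; module ≤-Reasoning)
open import Algebra.Properties.Group +-0-group using (//-rightDividesˡ; //-rightDividesʳ)
open import Algebra.Properties.AbelianGroup +-0-abelianGroup using (⁻¹-anti-homo‿-)
open import Relation.Nullary using (¬_)
open import Relation.Binary.PropositionalEquality using (_≡_; cong; sym; subst)

p≤∣p∣ : ∀ p → p ≤ ∣ p ∣
p≤∣p∣ p@(mkℚ (+ _)     _ _) = ≤-refl
p≤∣p∣ p@(mkℚ -[1+ _ ] _ _) = ≤-trans (<⇒≤ (negative⁻¹ p)) (0≤∣p∣ p)

∣p-q∣≡∣q-p∣ : ∀ p q → ∣ p - q ∣ ≡ ∣ q - p ∣
∣p-q∣≡∣q-p∣ p q = subst (λ x → ∣ x ∣ ≡ ∣ q - p ∣) (⁻¹-anti-homo‿- q p) (∣-p∣≡∣p∣ (q - p))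

p-q≤r⇒p≤r+q : ∀ {p q r} → p - q ≤ r → p ≤ r + q
p-q≤r⇒p≤r+q {p} {q} {r} p-q≤r =
  subst (_≤ r + q) (//-rightDividesˡ q p) (+-monoˡ-≤ q p-q≤r)

p≤r+q⇒p-r≤q : ∀ {p q r} → p ≤ r + q → p - r ≤ q
p≤r+q⇒p-r≤q {p} {q} {r} p≤r+q =
  subst (p - r ≤_) (//-rightDividesʳ r q) (+-monoˡ-≤ (- r) (≤-trans p≤r+q (≤-reflexive (+-comm r q))))

∣p-q∣≤r⇒p≤r+q : ∀ {p q r} → ∣ p - q ∣ ≤ r → p ≤ r + q
∣p-q∣≤r⇒p≤r+q {p} {q} h = p-q≤r⇒p≤r+q (≤-trans (p≤∣p∣ (p - q)) h)

∣p-q∣≤r⇒q≤r+p : ∀ {p q r} → ∣ p - q ∣ ≤ r → q ≤ r + p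
∣p-q∣≤r⇒q≤r+p {p} {q} h = ∣p-q∣≤r⇒p≤r+q (subst (_≤ _) (∣p-q∣≡∣q-p∣ p q) h)

approx-≤⇒≤-[β+β] : ∀ {a b c d β} → ∣ a - b ∣ ≤ β → ∣ c - d ∣ ≤ β → a ≤ c → b - (β + β) ≤ d
approx-≤⇒≤-[β+β] {a} {b} {c} {d} {β} a≈b c≈d a≤c = p≤r+q⇒p-r≤q (begin
  b             ≤⟨ ∣p-q∣≤r⇒q≤r+p a≈b ⟩
  β + a         ≤⟨ +-monoʳ-≤ β a≤c ⟩
  β + c         ≤⟨ +-monoʳ-≤ β (∣p-q∣≤r⇒p≤r+q c≈d) ⟩
  β + (β + d)   ≡⟨ +-assoc β β d ⟨
  (β + β) + d   ∎)
  where open ≤-Reasoning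

lemma9 : {n k : ℕ} (lab : Labeling n) →
    ((u v : Fin n) → lab u v ≡ lab v u) →
    (D : Clustering n k) (β : ℚ) → 0ℚ < β →
    (S : List (Fin n)) → BetaGood lab D β S →
    (u : Fin n) → ¬ (u ∈ S) →
    (r s : Fin k) → D u ≡ s → ¬ (r ≡ s) →
    ((i : Fin k) → pvalS lab D S u i ≤ pvalS lab D S u r) →
    (pvalD lab D u s - (β + β) ≤ pvalD lab D u r)
    × (pvalD lab D u s - (β + β) ≡ valD lab D u - (β + β))
lemma9 lab _ D β _ S (_ , close) u _ r s Du≡s _ r-maximises =
    approx-≤⇒≤-[β+β] (close u s) (close u r) (r-maximises s)
  , cong (λ t → pvalD lab D u t - (β + β)) (sym Du≡s)
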